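{- Let $\overline{(\cdot)}$ be the CPS translation of $\lambda\mathbf{J}^{\mathbf{mse}}$ into the $\lambda$-calculus given in the context. If $t\rightarrow u$ in $\lambda\mathbf{J}^{\mathbf{mse}}$, then $\overline{t}\rightarrow^*_\beta\overline{u}$ (zero or more $\beta$-steps) in the $\lambda$-calculus.
   Context: $\lambda\mathbf{J}^{\mathbf{mse}}$: terms $t,u,v::= x\mid \lambda x.t\mid \{c\}$; co-terms $l::= []\mid u::l\mid (x)c$; commands $c::= t\,l$; $(x)$ binds $x$ in $c$; capture-avoiding substitution. Evaluation contexts $E::=[]\mid u::l$. Append: $[]@l'=l'$, $(u::l)@l'=u::(l@l')$, $((x)\,t\,l)@l'=(x)\,t\,(l@l')$. Reduction $\rightarrow$: closure under all constructors of $(\lambda x.t)(u::l)\rightarrow u((x)t\,l)$; $\{t\,l\}E\rightarrow t(l@E)$; $t(x)c\rightarrow[t/x]c$; $(x)x\,l\rightarrow l$ if $x\notin l$; $\{t[]\}\rightarrow t$. CPS translation: for each expression $T$ and $\lambda$-term $K$, define $(T:K)$ by ($w,m$ fresh): $(x:K)=xK$; $(\lambda x.t:K)=K(\lambda wx.w\,\overline{t})$; $(\{c\}:K)=(c:K)$; $([]:K)=\lambda w.wK$; $(u::l:K)=\lambda w.w(\lambda m.m\,(l:K)\,\overline{u})$; $((x)c:K)=\lambda x.(c:K)$; $(t\,[]:K)=(t:K)$; $(t(u::l):K)=(t:\lambda m.m\,(l:K)\,\overline{u})$; $(t(x)c:K)=((x)c:K)\,\overline{t}$; and $\overline{t}=\lambda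 k.(t:k)$ with $k$ fresh. -}

module Defs where

open import Data.Nat using (ℕ; zero; suc)
open import Data.Fin using (Fin; zero; suc)
open import Function using (id; _∘_)
open import Relation.Binary.Construct.Closure.ReflexiveTransitive using (Star)

Ren : ℕ → ℕ → Set
Ren n m = Fin n → Fin m

ext : ∀ {n m} → Ren n m → Ren (suc n) (suc m)
ext ρ zero    = zero
ext ρ (suc i) = suc (ρ i)

-- The calculus λJ^mse (well-scoped de Bruijn syntax; index 0 = most
-- recently bound variable)

mutual
  data Term (n : ℕ) : Set where
    var   : Fin n → Term n
    lam   : Term (suc n) → Term n
    brace : Cmd n → Term n

  data CoTerm (n : ℕ) : Set where
    nil  : CoTerm n
    cons : Term n → CoTerm n → CoTerm n
    mu   : Cmd (suc n) → CoTerm n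

  data Cmd (n : ℕ) : Set where
    cmd : Term n → CoTerm n → Cmd n

mutual
  renT : ∀ {n m} → Ren n m → Term n → Term m
  renT ρ (var x)   = var (ρ x)
  renT ρ (lam t)   = lam (renT (ext ρ) t)
  renT ρ (brace c) = brace (renC ρ c)

  renL : ∀ {n m} → Ren n m → CoTerm n → CoTerm m
  renL ρ nil        = nil
  renL ρ (cons u l) = cons (renT ρ u) (renL ρ l)
  renL ρ (mu c)     = mu (renC (ext ρ) c)

  renC : ∀ {n m} → Ren n m → Cmd n → Cmd m
  renC ρ (cmd t l) = cmd (renT ρ t) (renL ρ l)

wkL : ∀ {n} → CoTerm n → CoTerm (suc n)
wkL = renL suc

Sub : ℕ → ℕ → Set
Sub n m = Fin n → Term m

exts : ∀ {n m} → Sub n m → Sub (suc n) (suc m)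
exts σ zero    = var zero
exts σ (suc i) = renT suc (σ i)

mutual
  subT : ∀ {n m} → Sub n m → Term n → Term m
  subT σ (var x)   = σ x
  subT σ (lam t)   = lam (subT (exts σ) t)
  subT σ (brace c) = brace (subC σ c)

  subL : ∀ {n m} → Sub n m → CoTerm n → CoTerm m
  subL σ nil        = nil
  subL σ (cons u l) = cons (subT σ u) (subL σ l)
  subL σ (mu c)     = mu (subC (exts σ) c)

  subC : ∀ {n m} → Sub n m → Cmd n → Cmd m
  subC σ (cmd t l) = cmd (subT σ t) (subL σ l)

single : ∀ {n} → Term n → Sub (suc n) n
single t zero    = t
single t (suc i) = var i

_[_/0]C : ∀ {n} → Cmd (suc n) → Term n → Cmd n
c [ t /0]C = subC (single t) c

_++L_ : ∀ {n} → CoTerm n → CoTerm n → CoTerm n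
nil        ++L l' = l'
cons u l   ++L l' = cons u (l ++L l')
mu (cmd t l) ++L l' = mu (cmd t (l ++L wkL l'))

data EvalCtx {n : ℕ} : CoTerm n → Set where
  ec-nil  : EvalCtx nil
  ec-cons : ∀ u l → EvalCtx (cons u l)

mutual
  data _⟶T_ {n : ℕ} : Term n → Term n → Set where
    ε-rule  : ∀ t → brace (cmd t nil) ⟶T t
    lam-cong   : ∀ {t t'} → t ⟶T t' → lam t ⟶T lam t'
    brace-cong : ∀ {c c'} → c ⟶C c' → brace c ⟶T brace c'

  data _⟶L_ {n : ℕ} : CoTerm n → CoTerm n → Set where
    -- (x) x l → l  if x ∉ l  (i.e. the body co-term is a weakening)
    μ-rule     : ∀ l → mu (cmd (var zero) (wkL l)) ⟶L l
    cons-congˡ : ∀ {u u' l} → u ⟶T u' → cons u l ⟶L cons u' l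
    cons-congʳ : ∀ {u l l'} → l ⟶L l' → cons u l ⟶L cons u l'
    mu-cong    : ∀ {c c'} → c ⟶C c' → mu c ⟶L mu c'

  data _⟶C_ {n : ℕ} : Cmd n → Cmd n → Set where
    β-rule : ∀ t u l → cmd (lam t) (cons u l) ⟶C cmd u (mu (cmd t (wkL l)))
    π-rule : ∀ t l E → EvalCtx E → cmd (brace (cmd t l)) E ⟶C cmd t (l ++L E)
    σ-rule : ∀ t c → cmd t (mu c) ⟶C (c [ t /0]C)
    cmd-congˡ : ∀ {t t' l} → t ⟶T t' → cmd t l ⟶C cmd t' l
    cmd-congʳ : ∀ {t l l'} → l ⟶L l' → cmd t l ⟶C cmd t l'

data Λ (n : ℕ) : Set where
  ` : Fin n → Λ n
  ƛ : Λ (suc n) → Λ n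
  _·_ : Λ n → Λ n → Λ n

infixl 7 _·_

renΛ : ∀ {n m} → Ren n m → Λ n → Λ m
renΛ ρ (` x)   = ` (ρ x)
renΛ ρ (ƛ t)   = ƛ (renΛ (ext ρ) t)
renΛ ρ (t · u) = renΛ ρ t · renΛ ρ u

extsΛ : ∀ {n m} → (Fin n → Λ m) → Fin (suc n) → Λ (suc m)
extsΛ σ zero    = ` zero
extsΛ σ (suc i) = renΛ suc (σ i)

subΛ : ∀ {n m} → (Fin n → Λ m) → Λ n → Λ m
subΛ σ (` x)   = σ x
subΛ σ (ƛ t)   = ƛ (subΛ (extsΛ σ) t)
subΛ σ (t · u) = subΛ σ t · subΛ σ u

singleΛ : ∀ {n} → Λ n → Fin (suc n) → Λ n
singleΛ u zero    = u
singleΛ u (suc i) = ` i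

data _→β_ {n : ℕ} : Λ n → Λ n → Set where
  β     : ∀ t u → (ƛ t · u) →β subΛ (singleΛ u) t
  ξ-ƛ   : ∀ {t t'} → t →β t' → ƛ t →β ƛ t'
  ξ-·ˡ  : ∀ {t t' u} → t →β t' → (t · u) →β (t' · u)
  ξ-·ʳ  : ∀ {t u u'} → u →β u' → (t · u) →β (t · u')

_→β*_ : ∀ {n} → Λ n → Λ n → Set
_→β*_ = Star _→β_

-- Implemented with an auxiliary renaming ρ from the scope of T into the
-- scope of K (to account for the fresh binders w, m, k); the paper's
-- translation is the instance ρ = id.

ext2 : ∀ {n m} → Ren n m → Ren (suc n) (suc (suc m))
ext2 ρ zero    = zero
ext2 ρ (suc i) = suc (suc (ρ i))

wkΛ : ∀ {n} → Λ n → Λ (suc n)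
wkΛ = renΛ suc

wk2 : ∀ {n m} → Ren n m → Ren n (suc (suc m))
wk2 ρ i = suc (suc (ρ i))

wk1 : ∀ {n m} → Ren n m → Ren n (suc m)
wk1 ρ i = suc (ρ i)

mutual
  barR : ∀ {n m} → Ren n m → Term n → Λ m
  barR ρ t = ƛ (cpsT (wk1 ρ) t (` zero))

  cpsT : ∀ {n m} → Ren n m → Term n → Λ m → Λ m
  cpsT ρ (var x)   K = ` (ρ x) · K
  -- (λx.t : K) = K (λw x. w t̄)     (w = index 1, x = index 0)
  cpsT ρ (lam t)   K = K · ƛ (ƛ (` (suc zero) · barR (ext2 ρ) t))
  cpsT ρ (brace c) K = cpsC ρ c K

  cpsL : ∀ {n m} → Ren n m → CoTerm n → Λ m → Λ m
  cpsL ρ nil        K = ƛ (` zero · wkΛ K)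
  cpsL ρ (cons u l) K =
    ƛ (` zero · ƛ (` zero · cpsL (wk2 ρ) l (wkΛ (wkΛ K))
                          · barR (wk2 ρ) u))
  cpsL ρ (mu c)     K = ƛ (cpsC (ext ρ) c (wkΛ K))

  cpsC : ∀ {n m} → Ren n m → Cmd n → Λ m → Λ m
  cpsC ρ (cmd t nil)        K = cpsT ρ t K
  cpsC ρ (cmd t (cons u l)) K =
    cpsT ρ t (ƛ (` zero · cpsL (wk1 ρ) l (wkΛ K) · barR (wk1 ρ) u))
  cpsC ρ (cmd t (mu c))     K = cpsL ρ (mu c) K · barR ρ t

bar : ∀ {n} → Term n → Λ n
bar = barR id

-- The translation is taken relative to a renaming ρ from the source into the
-- target scope, so that every lemma can be stated under the fresh binders.
-- Each root step is simulated by a few β-steps: the administrative redexes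
-- built by (λx.t : K) and (u::l : K) contract, and (t (x)c : K) = (λx.(c : K)) t̄
-- contracts to [t̄/x](c : K). The latter is related to ([t/x]c : K) by a
-- substitution lemma that holds only up to β, since an occurrence x K becomes
-- t̄ K →β (t : K). For the π-rule the translation of an evaluation context E is
-- a continuation k_E with (t l : k_E) = (t (l@E) : K) on the nose.
module Submission where

open import Data.Fin using (Fin; zero; suc)
open import Data.Nat using (suc)
open import Function using (id)
open import Relation.Binary.PropositionalEquality
  using (_≡_; refl; sym; trans; cong; cong₂; subst; module ≡-Reasoning)
open import Relation.Binary.Construct.Closure.ReflexiveTransitive
  using (ε; _◅_; _◅◅_; gmap)
open import Relation.Binary.Construct.Closure.ReflexiveTransitive.Properties
  using (module StarReasoning)

open import Defs

renΛ-cong : ∀ {n m} {θ θ' : Ren n m} → (∀ i → θ i ≡ θ' i) → ∀ t → renΛ θ t ≡ renΛ θ' t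
renΛ-cong h (` x)   = cong ` (h x)
renΛ-cong h (ƛ t)   = cong ƛ (renΛ-cong h' t)
  where
  h' : ∀ i → ext _ i ≡ ext _ i
  h' zero    = refl
  h' (suc i) = cong suc (h i)
renΛ-cong h (t · u) = cong₂ _·_ (renΛ-cong h t) (renΛ-cong h u)

subΛ-cong : ∀ {n m} {σ σ' : Fin n → Λ m} → (∀ i → σ i ≡ σ' i) → ∀ t → subΛ σ t ≡ subΛ σ' t
subΛ-cong h (` x)   = h x
subΛ-cong h (ƛ t)   = cong ƛ (subΛ-cong h' t)
  where
  h' : ∀ i → extsΛ _ i ≡ extsΛ _ i
  h' zero    = refl
  h' (suc i) = cong wkΛ (h i)
subΛ-cong h (t · u) = cong₂ _·_ (subΛ-cong h t) (subΛ-cong h u)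

renΛ-∘ : ∀ {n m k} (θ : Ren m k) (φ : Ren n m) t → renΛ θ (renΛ φ t) ≡ renΛ (λ i → θ (φ i)) t
renΛ-∘ θ φ (` x)   = refl
renΛ-∘ θ φ (ƛ t)   = cong ƛ (trans (renΛ-∘ (ext θ) (ext φ) t) (renΛ-cong h t))
  where
  h : ∀ i → ext θ (ext φ i) ≡ ext (λ i → θ (φ i)) i
  h zero    = refl
  h (suc i) = refl
renΛ-∘ θ φ (t · u) = cong₂ _·_ (renΛ-∘ θ φ t) (renΛ-∘ θ φ u)

renΛ-as-subΛ : ∀ {n m} (θ : Ren n m) t → renΛ θ t ≡ subΛ (λ i → ` (θ i)) t
renΛ-as-subΛ θ (` x)   = refl
renΛ-as-subΛ θ (ƛ t)   = cong ƛ (trans (renΛ-as-subΛ (ext θ) t) (subΛ-cong h t))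
  where
  h : ∀ i → ` (ext θ i) ≡ extsΛ (λ i → ` (θ i)) i
  h zero    = refl
  h (suc i) = refl
renΛ-as-subΛ θ (t · u) = cong₂ _·_ (renΛ-as-subΛ θ t) (renΛ-as-subΛ θ u)

subΛ-id : ∀ {n} (t : Λ n) → subΛ ` t ≡ t
subΛ-id (` x)   = refl
subΛ-id (ƛ t)   = cong ƛ (trans (subΛ-cong h t) (subΛ-id t))
  where
  h : ∀ i → extsΛ ` i ≡ ` i
  h zero    = refl
  h (suc i) = refl
subΛ-id (t · u) = cong₂ _·_ (subΛ-id t) (subΛ-id u)

subΛ-renΛ : ∀ {n m k} (σ : Fin m → Λ k) (θ : Ren n m) t →
            subΛ σ (renΛ θ t) ≡ subΛ (λ i → σ (θ i)) t
subΛ-renΛ σ θ (` x)   = refl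
subΛ-renΛ σ θ (ƛ t)   = cong ƛ (trans (subΛ-renΛ (extsΛ σ) (ext θ) t) (subΛ-cong h t))
  where
  h : ∀ i → extsΛ σ (ext θ i) ≡ extsΛ (λ i → σ (θ i)) i
  h zero    = refl
  h (suc i) = refl
subΛ-renΛ σ θ (t · u) = cong₂ _·_ (subΛ-renΛ σ θ t) (subΛ-renΛ σ θ u)

renΛ-subΛ : ∀ {n m k} (θ : Ren m k) (σ : Fin n → Λ m) t →
            renΛ θ (subΛ σ t) ≡ subΛ (λ i → renΛ θ (σ i)) t
renΛ-subΛ θ σ (` x)   = refl
renΛ-subΛ θ σ (ƛ t)   = cong ƛ (trans (renΛ-subΛ (ext θ) (extsΛ σ) t) (subΛ-cong h t))
  where
  h : ∀ i → renΛ (ext θ) (extsΛ σ i) ≡ extsΛ (λ i → renΛ θ (σ i)) i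
  h zero    = refl
  h (suc i) = trans (renΛ-∘ (ext θ) suc (σ i)) (sym (renΛ-∘ suc θ (σ i)))
renΛ-subΛ θ σ (t · u) = cong₂ _·_ (renΛ-subΛ θ σ t) (renΛ-subΛ θ σ u)

renΛ-ext-wkΛ : ∀ {n m} (θ : Ren n m) t → renΛ (ext θ) (wkΛ t) ≡ wkΛ (renΛ θ t)
renΛ-ext-wkΛ θ t = trans (renΛ-∘ (ext θ) suc t) (sym (renΛ-∘ suc θ t))

subΛ-exts-wkΛ : ∀ {n m} (σ : Fin n → Λ m) t → subΛ (extsΛ σ) (wkΛ t) ≡ wkΛ (subΛ σ t)
subΛ-exts-wkΛ σ t = trans (subΛ-renΛ (extsΛ σ) suc t) (sym (renΛ-subΛ suc σ t))

subΛ-exts²-wkΛ² : ∀ {n m} (σ : Fin n → Λ m) t →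
                  subΛ (extsΛ (extsΛ σ)) (wkΛ (wkΛ t)) ≡ wkΛ (wkΛ (subΛ σ t))
subΛ-exts²-wkΛ² σ t = trans (subΛ-exts-wkΛ (extsΛ σ) (wkΛ t)) (cong wkΛ (subΛ-exts-wkΛ σ t))

subΛ-single-wkΛ : ∀ {n} (u t : Λ n) → subΛ (singleΛ u) (wkΛ t) ≡ t
subΛ-single-wkΛ u t = trans (subΛ-renΛ (singleΛ u) suc t) (subΛ-id t)

renΛ-→β : ∀ {n m} (θ : Ren n m) {t t'} → t →β t' → renΛ θ t →β renΛ θ t'
renΛ-→β θ (β t u)  = subst (λ z → renΛ θ (ƛ t · u) →β z) commute (β (renΛ (ext θ) t) (renΛ θ u))
  where
  h : ∀ i → singleΛ (renΛ θ u) (ext θ i) ≡ renΛ θ (singleΛ u i)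
  h zero    = refl
  h (suc i) = refl
  commute : subΛ (singleΛ (renΛ θ u)) (renΛ (ext θ) t) ≡ renΛ θ (subΛ (singleΛ u) t)
  commute = trans (subΛ-renΛ _ (ext θ) t)
                  (trans (subΛ-cong h t) (sym (renΛ-subΛ θ (singleΛ u) t)))
renΛ-→β θ (ξ-ƛ s)  = ξ-ƛ (renΛ-→β (ext θ) s)
renΛ-→β θ (ξ-·ˡ s) = ξ-·ˡ (renΛ-→β θ s)
renΛ-→β θ (ξ-·ʳ s) = ξ-·ʳ (renΛ-→β θ s)

ξ-ƛ* : ∀ {n} {t t' : Λ (suc n)} → t →β* t' → ƛ t →β* ƛ t'
ξ-ƛ* = gmap ƛ ξ-ƛ

ξ-·ˡ* : ∀ {n} {t t' u : Λ n} → t →β* t' → (t · u) →β* (t' · u)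
ξ-·ˡ* {u = u} = gmap (_· u) ξ-·ˡ

ξ-·ʳ* : ∀ {n} {t u u' : Λ n} → u →β* u' → (t · u) →β* (t · u')
ξ-·ʳ* {t = t} = gmap (t ·_) ξ-·ʳ

ξ-·* : ∀ {n} {t t' u u' : Λ n} → t →β* t' → u →β* u' → (t · u) →β* (t' · u')
ξ-·* p q = ξ-·ˡ* p ◅◅ ξ-·ʳ* q

≡⇒→β* : ∀ {n} {t u : Λ n} → t ≡ u → t →β* u
≡⇒→β* refl = ε

record ActsAsRenaming {n m m'} (τ : Fin m → Λ m') (ρ : Ren n m) (ρ' : Ren n m') : Set where
  constructor actsAsRenaming
  field acts : ∀ i → τ (ρ i) ≡ ` (ρ' i)
open ActsAsRenaming

actsAsRenaming-wk : ∀ {n m m'} {τ : Fin m → Λ m'} {ρ : Ren n m} {ρ'} →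
                    ActsAsRenaming τ ρ ρ' → ActsAsRenaming (extsΛ τ) (wk1 ρ) (wk1 ρ')
actsAsRenaming-wk h = actsAsRenaming λ i → cong wkΛ (acts h i)

actsAsRenaming-ext : ∀ {n m m'} {τ : Fin m → Λ m'} {ρ : Ren n m} {ρ'} →
                     ActsAsRenaming τ ρ ρ' → ActsAsRenaming (extsΛ τ) (ext ρ) (ext ρ')
actsAsRenaming-ext h = actsAsRenaming λ { zero → refl ; (suc i) → cong wkΛ (acts h i) }

actsAsRenaming-ext2 : ∀ {n m m'} {τ : Fin m → Λ m'} {ρ : Ren n m} {ρ'} →
                      ActsAsRenaming τ ρ ρ' →
                      ActsAsRenaming (extsΛ (extsΛ τ)) (ext2 ρ) (ext2 ρ')
actsAsRenaming-ext2 h =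
  actsAsRenaming λ { zero → refl ; (suc i) → cong (λ z → wkΛ (wkΛ z)) (acts h i) }

mutual
  subΛ-cpsT : ∀ {n m m'} {τ : Fin m → Λ m'} {ρ : Ren n m} {ρ'} → ActsAsRenaming τ ρ ρ' →
              ∀ t K → subΛ τ (cpsT ρ t K) ≡ cpsT ρ' t (subΛ τ K)
  subΛ-cpsT {τ = τ} h (var x)   K = cong (_· subΛ τ K) (acts h x)
  subΛ-cpsT {τ = τ} h (lam t)   K =
    cong (λ z → subΛ τ K · ƛ (ƛ (` (suc zero) · z))) (subΛ-barR (actsAsRenaming-ext2 h) t)
  subΛ-cpsT         h (brace c) K = subΛ-cpsC h c K

  subΛ-barR : ∀ {n m m'} {τ : Fin m → Λ m'} {ρ : Ren n m} {ρ'} → ActsAsRenaming τ ρ ρ' →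
              ∀ t → subΛ τ (barR ρ t) ≡ barR ρ' t
  subΛ-barR h t = cong ƛ (subΛ-cpsT (actsAsRenaming-wk h) t (` zero))

  subΛ-cpsL : ∀ {n m m'} {τ : Fin m → Λ m'} {ρ : Ren n m} {ρ'} → ActsAsRenaming τ ρ ρ' →
              ∀ l K → subΛ τ (cpsL ρ l K) ≡ cpsL ρ' l (subΛ τ K)
  subΛ-cpsL {τ = τ} h nil K = cong (λ z → ƛ (` zero · z)) (subΛ-exts-wkΛ τ K)
  subΛ-cpsL {τ = τ} {ρ' = ρ'} h (cons u l) K =
    cong₂ (λ a b → ƛ (` zero · ƛ (` zero · a · b)))
      (trans (subΛ-cpsL h₂ l _) (cong (cpsL (wk2 ρ') l) (subΛ-exts²-wkΛ² τ K)))
      (subΛ-barR h₂ u)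
    where h₂ = actsAsRenaming-wk (actsAsRenaming-wk h)
  subΛ-cpsL {τ = τ} {ρ' = ρ'} h (mu c) K =
    cong ƛ (trans (subΛ-cpsC (actsAsRenaming-ext h) c _)
                  (cong (cpsC (ext ρ') c) (subΛ-exts-wkΛ τ K)))

  subΛ-cpsC : ∀ {n m m'} {τ : Fin m → Λ m'} {ρ : Ren n m} {ρ'} → ActsAsRenaming τ ρ ρ' →
              ∀ c K → subΛ τ (cpsC ρ c K) ≡ cpsC ρ' c (subΛ τ K)
  subΛ-cpsC h (cmd t nil)        K = subΛ-cpsT h t K
  subΛ-cpsC {τ = τ} {ρ' = ρ'} h (cmd t (cons u l)) K =
    trans (subΛ-cpsT h t _)
      (cong (cpsT ρ' t)
        (cong₂ (λ a b → ƛ (` zero · a · b))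
          (trans (subΛ-cpsL h₁ l _) (cong (cpsL (wk1 ρ') l) (subΛ-exts-wkΛ τ K)))
          (subΛ-barR h₁ u)))
    where h₁ = actsAsRenaming-wk h
  subΛ-cpsC h (cmd t (mu c))     K = cong₂ _·_ (subΛ-cpsL h (mu c) K) (subΛ-barR h t)

renΛ-cpsL : ∀ {n m m'} (θ : Ren m m') (ρ : Ren n m) l K →
            renΛ θ (cpsL ρ l K) ≡ cpsL (λ i → θ (ρ i)) l (renΛ θ K)
renΛ-cpsL θ ρ l K = begin
  renΛ θ (cpsL ρ l K)                        ≡⟨ renΛ-as-subΛ θ _ ⟩
  subΛ (λ i → ` (θ i)) (cpsL ρ l K)          ≡⟨ subΛ-cpsL (actsAsRenaming λ _ → refl) l K ⟩
  cpsL _ l (subΛ (λ i → ` (θ i)) K)          ≡⟨ cong (cpsL _ l) (sym (renΛ-as-subΛ θ K)) ⟩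
  cpsL (λ i → θ (ρ i)) l (renΛ θ K)          ∎
  where open ≡-Reasoning

renΛ-barR : ∀ {n m m'} (θ : Ren m m') (ρ : Ren n m) t →
            renΛ θ (barR ρ t) ≡ barR (λ i → θ (ρ i)) t
renΛ-barR θ ρ t = trans (renΛ-as-subΛ θ _) (subΛ-barR (actsAsRenaming λ _ → refl) t)

barR-app : ∀ {n m} (ρ : Ren n m) t K → (barR ρ t · K) →β* cpsT ρ t K
barR-app ρ t K = β _ K ◅ ≡⇒→β* (subΛ-cpsT (actsAsRenaming λ _ → refl) t (` zero))

record Factors {n n' m} (φ : Ren n n') (ρ : Ren n' m) (ρ' : Ren n m) : Set where
  constructor factors
  field factor : ∀ i → ρ (φ i) ≡ ρ' i
open Factors

factors-wk : ∀ {n n' m} {φ : Ren n n'} {ρ : Ren n' m} {ρ'} →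
             Factors φ ρ ρ' → Factors φ (wk1 ρ) (wk1 ρ')
factors-wk h = factors λ i → cong suc (factor h i)

factors-ext : ∀ {n n' m} {φ : Ren n n'} {ρ : Ren n' m} {ρ'} →
              Factors φ ρ ρ' → Factors (ext φ) (ext ρ) (ext ρ')
factors-ext h = factors λ { zero → refl ; (suc i) → cong suc (factor h i) }

factors-ext2 : ∀ {n n' m} {φ : Ren n n'} {ρ : Ren n' m} {ρ'} →
               Factors φ ρ ρ' → Factors (ext φ) (ext2 ρ) (ext2 ρ')
factors-ext2 h = factors λ { zero → refl ; (suc i) → cong (λ z → suc (suc z)) (factor h i) }

mutual
  cpsT-renT : ∀ {n n' m} {φ : Ren n n'} {ρ : Ren n' m} {ρ'} → Factors φ ρ ρ' →
              ∀ t K → cpsT ρ (renT φ t) K ≡ cpsT ρ' t K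
  cpsT-renT h (var x)   K = cong (λ z → ` z · K) (factor h x)
  cpsT-renT h (lam t)   K =
    cong (λ z → K · ƛ (ƛ (` (suc zero) · z))) (barR-renT (factors-ext2 h) t)
  cpsT-renT h (brace c) K = cpsC-renC h c K

  barR-renT : ∀ {n n' m} {φ : Ren n n'} {ρ : Ren n' m} {ρ'} → Factors φ ρ ρ' →
              ∀ t → barR ρ (renT φ t) ≡ barR ρ' t
  barR-renT h t = cong ƛ (cpsT-renT (factors-wk h) t (` zero))

  cpsL-renL : ∀ {n n' m} {φ : Ren n n'} {ρ : Ren n' m} {ρ'} → Factors φ ρ ρ' →
              ∀ l K → cpsL ρ (renL φ l) K ≡ cpsL ρ' l K
  cpsL-renL h nil        K = refl
  cpsL-renL h (cons u l) K =
    cong₂ (λ a b → ƛ (` zero · ƛ (` zero · a · b))) (cpsL-renL h₂ l _) (barR-renT h₂ u)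
    where h₂ = factors-wk (factors-wk h)
  cpsL-renL h (mu c)     K = cong ƛ (cpsC-renC (factors-ext h) c _)

  cpsC-renC : ∀ {n n' m} {φ : Ren n n'} {ρ : Ren n' m} {ρ'} → Factors φ ρ ρ' →
              ∀ c K → cpsC ρ (renC φ c) K ≡ cpsC ρ' c K
  cpsC-renC h (cmd t nil)        K = cpsT-renT h t K
  cpsC-renC {ρ' = ρ'} h (cmd t (cons u l)) K =
    trans (cpsT-renT h t _)
      (cong (cpsT ρ' t)
        (cong₂ (λ a b → ƛ (` zero · a · b)) (cpsL-renL h₁ l _) (barR-renT h₁ u)))
    where h₁ = factors-wk h
  cpsC-renC h (cmd t (mu c))     K = cong₂ _·_ (cpsL-renL h (mu c) K) (barR-renT h t)

exts-var : ∀ {n} {σ : Sub n n} → (∀ i → σ i ≡ var i) → ∀ i → exts σ i ≡ var i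
exts-var h zero    = refl
exts-var h (suc i) = cong (renT suc) (h i)

mutual
  subT-var : ∀ {n} {σ : Sub n n} → (∀ i → σ i ≡ var i) → ∀ t → subT σ t ≡ t
  subT-var h (var x)   = h x
  subT-var h (lam t)   = cong lam (subT-var (exts-var h) t)
  subT-var h (brace c) = cong brace (subC-var h c)

  subL-var : ∀ {n} {σ : Sub n n} → (∀ i → σ i ≡ var i) → ∀ l → subL σ l ≡ l
  subL-var h nil        = refl
  subL-var h (cons u l) = cong₂ cons (subT-var h u) (subL-var h l)
  subL-var h (mu c)     = cong mu (subC-var (exts-var h) c)

  subC-var : ∀ {n} {σ : Sub n n} → (∀ i → σ i ≡ var i) → ∀ c → subC σ c ≡ c
  subC-var h (cmd t l) = cong₂ cmd (subT-var h t) (subL-var h l)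

mutual
  cpsT-mono : ∀ {n m} (ρ : Ren n m) t {K K'} → K →β K' → cpsT ρ t K →β cpsT ρ t K'
  cpsT-mono ρ (var x)   s = ξ-·ʳ s
  cpsT-mono ρ (lam t)   s = ξ-·ˡ s
  cpsT-mono ρ (brace c) s = cpsC-mono ρ c s

  cpsL-mono : ∀ {n m} (ρ : Ren n m) l {K K'} → K →β K' → cpsL ρ l K →β cpsL ρ l K'
  cpsL-mono ρ nil        s = ξ-ƛ (ξ-·ʳ (renΛ-→β suc s))
  cpsL-mono ρ (cons u l) s =
    ξ-ƛ (ξ-·ʳ (ξ-ƛ (ξ-·ˡ (ξ-·ʳ (cpsL-mono (wk2 ρ) l (renΛ-→β suc (renΛ-→β suc s)))))))
  cpsL-mono ρ (mu c)     s = ξ-ƛ (cpsC-mono (ext ρ) c (renΛ-→β suc s))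

  cpsC-mono : ∀ {n m} (ρ : Ren n m) c {K K'} → K →β K' → cpsC ρ c K →β cpsC ρ c K'
  cpsC-mono ρ (cmd t nil)        s = cpsT-mono ρ t s
  cpsC-mono ρ (cmd t (cons u l)) s =
    cpsT-mono ρ t (ξ-ƛ (ξ-·ˡ (ξ-·ʳ (cpsL-mono (wk1 ρ) l (renΛ-→β suc s)))))
  cpsC-mono ρ (cmd t (mu c))     s = ξ-·ˡ (cpsL-mono ρ (mu c) s)

cpsT-mono* : ∀ {n m} (ρ : Ren n m) t {K K'} → K →β* K' → cpsT ρ t K →β* cpsT ρ t K'
cpsT-mono* ρ t = gmap (cpsT ρ t) (cpsT-mono ρ t)

-- X may stand for t in the target: either X = t̄, or t is a variable and X is
-- its renaming (which t̄ = λk. x k only η-expands).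
data Translates {n m} (ρ : Ren n m) : Term n → Λ m → Set where
  translated : ∀ {t} → Translates ρ t (barR ρ t)
  renamed    : ∀ {x} → Translates ρ (var x) (` (ρ x))

translates-app : ∀ {n m} {ρ : Ren n m} {t X} → Translates ρ t X →
                 ∀ K → (X · K) →β* cpsT ρ t K
translates-app {ρ = ρ} (translated {t}) K = barR-app ρ t K
translates-app renamed                   K = ε

translates-wk : ∀ {n m} {ρ : Ren n m} {t X} → Translates ρ t X → Translates (wk1 ρ) t (wkΛ X)
translates-wk {ρ = ρ} (translated {t}) =
  subst (Translates (wk1 ρ) t) (sym (renΛ-barR suc ρ t)) translated
translates-wk renamed = renamed

translates-renT : ∀ {n n' m} {φ : Ren n n'} {ρ : Ren n' m} {ρ'} → Factors φ ρ ρ' →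
                  ∀ {t X} → Translates ρ' t X → Translates ρ (renT φ t) X
translates-renT {ρ = ρ} h (translated {t}) =
  subst (Translates ρ (renT _ t)) (barR-renT h t) translated
translates-renT {ρ = ρ} h (renamed {x}) =
  subst (λ y → Translates ρ (var _) (` y)) (factor h x) renamed

record Instantiates {n n' m m'} (τ : Fin m → Λ m') (ρ : Ren n m) (ρ' : Ren n' m')
                    (σ : Sub n n') : Set where
  constructor instantiates
  field translates : ∀ i → Translates ρ' (σ i) (τ (ρ i))
open Instantiates

instantiates-wk : ∀ {n n' m m'} {τ : Fin m → Λ m'} {ρ : Ren n m} {ρ' : Ren n' m'} {σ} →
                  Instantiates τ ρ ρ' σ → Instantiates (extsΛ τ) (wk1 ρ) (wk1 ρ') σ
instantiates-wk h = instantiates λ i → translates-wk (translates h i)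

instantiates-ext : ∀ {n n' m m'} {τ : Fin m → Λ m'} {ρ : Ren n m} {ρ' : Ren n' m'} {σ} →
                   Instantiates τ ρ ρ' σ → Instantiates (extsΛ τ) (ext ρ) (ext ρ') (exts σ)
instantiates-ext h = instantiates λ
  { zero    → renamed
  ; (suc i) → translates-renT (factors λ _ → refl) (translates-wk (translates h i)) }

instantiates-ext2 : ∀ {n n' m m'} {τ : Fin m → Λ m'} {ρ : Ren n m} {ρ' : Ren n' m'} {σ} →
                    Instantiates τ ρ ρ' σ →
                    Instantiates (extsΛ (extsΛ τ)) (ext2 ρ) (ext2 ρ') (exts σ)
instantiates-ext2 h = instantiates λ
  { zero    → renamed
  ; (suc i) → translates-renT (factors λ _ → refl)
                (translates-wk (translates-wk (translates h i))) }

mutual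
  subΛ-cpsT-→β* : ∀ {n n' m m'} {τ : Fin m → Λ m'} {ρ : Ren n m} {ρ' : Ren n' m'} {σ} →
                  Instantiates τ ρ ρ' σ →
                  ∀ t K → subΛ τ (cpsT ρ t K) →β* cpsT ρ' (subT σ t) (subΛ τ K)
  subΛ-cpsT-→β* {τ = τ} h (var x)   K = translates-app (translates h x) (subΛ τ K)
  subΛ-cpsT-→β*         h (lam t)   K =
    ξ-·ʳ* (ξ-ƛ* (ξ-ƛ* (ξ-·ʳ* (subΛ-barR-→β* (instantiates-ext2 h) t))))
  subΛ-cpsT-→β*         h (brace c) K = subΛ-cpsC-→β* h c K

  subΛ-barR-→β* : ∀ {n n' m m'} {τ : Fin m → Λ m'} {ρ : Ren n m} {ρ' : Ren n' m'} {σ} →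
                  Instantiates τ ρ ρ' σ → ∀ t → subΛ τ (barR ρ t) →β* barR ρ' (subT σ t)
  subΛ-barR-→β* h t = ξ-ƛ* (subΛ-cpsT-→β* (instantiates-wk h) t (` zero))

  subΛ-cpsL-→β* : ∀ {n n' m m'} {τ : Fin m → Λ m'} {ρ : Ren n m} {ρ' : Ren n' m'} {σ} →
                  Instantiates τ ρ ρ' σ →
                  ∀ l K → subΛ τ (cpsL ρ l K) →β* cpsL ρ' (subL σ l) (subΛ τ K)
  subΛ-cpsL-→β* {τ = τ} h nil K = ≡⇒→β* (cong (λ z → ƛ (` zero · z)) (subΛ-exts-wkΛ τ K))
  subΛ-cpsL-→β* {τ = τ} {ρ' = ρ'} {σ} h (cons u l) K =
    ξ-ƛ* (ξ-·ʳ* (ξ-ƛ* (ξ-·* (ξ-·ʳ* (subΛ-cpsL-→β* h₂ l _ ◅◅ ≡⇒→β* continuation))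
                              (subΛ-barR-→β* h₂ u))))
    where
    h₂ = instantiates-wk (instantiates-wk h)
    continuation : cpsL (wk2 ρ') (subL σ l) (subΛ (extsΛ (extsΛ τ)) (wkΛ (wkΛ K)))
                 ≡ cpsL (wk2 ρ') (subL σ l) (wkΛ (wkΛ (subΛ τ K)))
    continuation = cong (cpsL (wk2 ρ') (subL σ l)) (subΛ-exts²-wkΛ² τ K)
  subΛ-cpsL-→β* {τ = τ} {ρ' = ρ'} {σ} h (mu c) K =
    ξ-ƛ* (subΛ-cpsC-→β* (instantiates-ext h) c _
          ◅◅ ≡⇒→β* (cong (cpsC (ext ρ') (subC (exts σ) c)) (subΛ-exts-wkΛ τ K)))

  subΛ-cpsC-→β* : ∀ {n n' m m'} {τ : Fin m → Λ m'} {ρ : Ren n m} {ρ' : Ren n' m'} {σ} →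
                  Instantiates τ ρ ρ' σ →
                  ∀ c K → subΛ τ (cpsC ρ c K) →β* cpsC ρ' (subC σ c) (subΛ τ K)
  subΛ-cpsC-→β* h (cmd t nil)        K = subΛ-cpsT-→β* h t K
  subΛ-cpsC-→β* {τ = τ} {ρ' = ρ'} {σ} h (cmd t (cons u l)) K =
    subΛ-cpsT-→β* h t _ ◅◅
    cpsT-mono* ρ' (subT σ t)
      (ξ-ƛ* (ξ-·* (ξ-·ʳ* (subΛ-cpsL-→β* h₁ l _ ◅◅ ≡⇒→β* continuation))
                  (subΛ-barR-→β* h₁ u)))
    where
    h₁ = instantiates-wk h
    continuation : cpsL (wk1 ρ') (subL σ l) (subΛ (extsΛ τ) (wkΛ K))
                 ≡ cpsL (wk1 ρ') (subL σ l) (wkΛ (subΛ τ K))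
    continuation = cong (cpsL (wk1 ρ') (subL σ l)) (subΛ-exts-wkΛ τ K)
  subΛ-cpsC-→β* h (cmd t (mu c))     K =
    ξ-·* (subΛ-cpsL-→β* h (mu c) K) (subΛ-barR-→β* h t)

-- cpsC ρ (cmd t E) K = cpsT ρ t (cpsE e ρ K).
cpsE : ∀ {n m} {E : CoTerm n} → EvalCtx E → Ren n m → Λ m → Λ m
cpsE ec-nil        ρ K = K
cpsE (ec-cons u l) ρ K = ƛ (` zero · cpsL (wk1 ρ) l (wkΛ K) · barR (wk1 ρ) u)

evalCtx-renL : ∀ {n n'} {E : CoTerm n} (φ : Ren n n') → EvalCtx E → EvalCtx (renL φ E)
evalCtx-renL φ ec-nil        = ec-nil
evalCtx-renL φ (ec-cons u l) = ec-cons (renT φ u) (renL φ l)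

renΛ-cpsE : ∀ {n m m'} {E : CoTerm n} (e : EvalCtx E) (θ : Ren m m') (ρ : Ren n m) K →
            renΛ θ (cpsE e ρ K) ≡ cpsE e (λ i → θ (ρ i)) (renΛ θ K)
renΛ-cpsE ec-nil        θ ρ K = refl
renΛ-cpsE (ec-cons u l) θ ρ K = cong ƛ (cong₂ (λ a b → ` zero · a · b)
  (trans (renΛ-cpsL (ext θ) (wk1 ρ) l (wkΛ K)) (cong (cpsL _ l) (renΛ-ext-wkΛ θ K)))
  (renΛ-barR (ext θ) (wk1 ρ) u))

cpsE-renL : ∀ {n n' m} {E : CoTerm n} (e : EvalCtx E) {φ : Ren n n'} {ρ : Ren n' m} {ρ'} →
            Factors φ ρ ρ' → ∀ K → cpsE (evalCtx-renL φ e) ρ K ≡ cpsE e ρ' K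
cpsE-renL ec-nil        h K = refl
cpsE-renL (ec-cons u l) h K =
  cong ƛ (cong₂ (λ a b → ` zero · a · b) (cpsL-renL h₁ l _) (barR-renT h₁ u))
  where h₁ = factors-wk h

cpsL-evalCtx : ∀ {n m} {E : CoTerm n} (e : EvalCtx E) (ρ : Ren n m) K →
               cpsL ρ E K ≡ ƛ (` zero · wkΛ (cpsE e ρ K))
cpsL-evalCtx ec-nil        ρ K = refl
cpsL-evalCtx (ec-cons u l) ρ K = sym (cong (λ z → ƛ (` zero · ƛ z)) (cong₂ (λ a b → ` zero · a · b)
  (trans (renΛ-cpsL (ext suc) (wk1 ρ) l (wkΛ K)) (cong (cpsL (wk2 ρ) l) (renΛ-ext-wkΛ suc K)))
  (renΛ-barR (ext suc) (wk1 ρ) u)))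

mutual
  cpsC-++L : ∀ {n m} {E : CoTerm n} (e : EvalCtx E) (ρ : Ren n m) t l K →
             cpsC ρ (cmd t l) (cpsE e ρ K) ≡ cpsC ρ (cmd t (l ++L E)) K
  cpsC-++L ec-nil        ρ t nil K = refl
  cpsC-++L (ec-cons _ _) ρ t nil K = refl
  cpsC-++L e ρ t (cons u l) K = cong (λ z → cpsT ρ t (ƛ (` zero · z · barR (wk1 ρ) u)))
    (trans (cong (cpsL (wk1 ρ) l) (renΛ-cpsE e suc ρ K)) (cpsL-++L e (wk1 ρ) l (wkΛ K)))
  cpsC-++L e ρ t (mu (cmd t' l)) K = cong (_· barR ρ t) (cpsL-++L e ρ (mu (cmd t' l)) K)

  cpsL-++L : ∀ {n m} {E : CoTerm n} (e : EvalCtx E) (ρ : Ren n m) l K →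
             cpsL ρ l (cpsE e ρ K) ≡ cpsL ρ (l ++L E) K
  cpsL-++L e ρ nil K = sym (cpsL-evalCtx e ρ K)
  cpsL-++L e ρ (cons u l) K = cong (λ z → ƛ (` zero · ƛ (` zero · z · barR (wk2 ρ) u)))
    (trans (cong (cpsL (wk2 ρ) l)
                 (trans (cong wkΛ (renΛ-cpsE e suc ρ K)) (renΛ-cpsE e suc (wk1 ρ) (wkΛ K))))
           (cpsL-++L e (wk2 ρ) l (wkΛ (wkΛ K))))
  cpsL-++L e ρ (mu (cmd t l)) K = cong ƛ
    (trans (cong (cpsC (ext ρ) (cmd t l))
                 (trans (renΛ-cpsE e suc ρ K) (sym (cpsE-renL e (factors λ _ → refl) (wkΛ K)))))
           (cpsC-++L (evalCtx-renL suc e) (ext ρ) t l (wkΛ K)))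

cpsL-app : ∀ {n m} (ρ : Ren n m) l t K → (cpsL ρ l K · barR ρ t) →β* cpsC ρ (cmd t l) K
cpsL-app ρ nil        t K =
  β _ _ ◅ ≡⇒→β* (cong (barR ρ t ·_) (subΛ-single-wkΛ (barR ρ t) K)) ◅◅ barR-app ρ t K
cpsL-app ρ (cons u l) t K = β _ _ ◅ ≡⇒→β* (cong (barR ρ t ·_) continuation) ◅◅ barR-app ρ t _
  where
  h : ActsAsRenaming (extsΛ (singleΛ (barR ρ t))) (wk2 ρ) (wk1 ρ)
  h = actsAsRenaming λ _ → refl
  continuation : subΛ (singleΛ (barR ρ t))
                   (ƛ (` zero · cpsL (wk2 ρ) l (wkΛ (wkΛ K)) · barR (wk2 ρ) u))
               ≡ ƛ (` zero · cpsL (wk1 ρ) l (wkΛ K) · barR (wk1 ρ) u)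
  continuation = cong ƛ (cong₂ (λ a b → ` zero · a · b)
    (trans (subΛ-cpsL h l _)
           (cong (cpsL (wk1 ρ) l) (trans (subΛ-exts-wkΛ _ (wkΛ K))
                                         (cong wkΛ (subΛ-single-wkΛ (barR ρ t) K)))))
    (subΛ-barR h u))
cpsL-app ρ (mu c)     t K = ε

simulate-β : ∀ {n m} (ρ : Ren n m) t u l K →
             cpsC ρ (cmd (lam t) (cons u l)) K →β* cpsC ρ (cmd u (mu (cmd t (wkL l)))) K
simulate-β {m = m} ρ t u l K = begin
  ƛ (` zero · cpsL (wk1 ρ) l (wkΛ K) · barR (wk1 ρ) u) · V
    ⟶⟨ β _ V ⟩
  V · subΛ (singleΛ V) (cpsL (wk1 ρ) l (wkΛ K)) · subΛ (singleΛ V) (barR (wk1 ρ) u)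
    ≡⟨ cong₂ (λ a b → V · a · b) substituted-l substituted-u ⟩
  V · L · U
    ⟶⟨ ξ-·ˡ (β _ L) ⟩
  ƛ (wkΛ L · subΛ (extsΛ (singleΛ L)) (barR (ext2 ρ) t)) · U
    ≡⟨ cong (λ z → ƛ (z · subΛ (extsΛ (singleΛ L)) (barR (ext2 ρ) t)) · U) weakened-l ⟩
  ƛ (cpsL (ext ρ) (wkL l) (wkΛ K) · subΛ (extsΛ (singleΛ L)) (barR (ext2 ρ) t)) · U
    ≡⟨ cong (λ z → ƛ (cpsL (ext ρ) (wkL l) (wkΛ K) · z) · U) substituted-t ⟩
  ƛ (cpsL (ext ρ) (wkL l) (wkΛ K) · barR (ext ρ) t) · U
    ⟶*⟨ ξ-·ˡ* (ξ-ƛ* (cpsL-app (ext ρ) (wkL l) t (wkΛ K))) ⟩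
  ƛ (cpsC (ext ρ) (cmd t (wkL l)) (wkΛ K)) · U
    ∎
  where
  open StarReasoning (_→β_ {m})
  V = ƛ (ƛ (` (suc zero) · barR (ext2 ρ) t))
  L = cpsL ρ l K
  U = barR ρ u
  substituted-l : subΛ (singleΛ V) (cpsL (wk1 ρ) l (wkΛ K)) ≡ L
  substituted-l = trans (subΛ-cpsL (actsAsRenaming λ _ → refl) l _)
                        (cong (cpsL ρ l) (subΛ-single-wkΛ V K))
  substituted-u : subΛ (singleΛ V) (barR (wk1 ρ) u) ≡ U
  substituted-u = subΛ-barR (actsAsRenaming λ _ → refl) u
  weakened-l : wkΛ L ≡ cpsL (ext ρ) (wkL l) (wkΛ K)
  weakened-l = trans (renΛ-cpsL suc ρ l K) (sym (cpsL-renL (factors λ _ → refl) l (wkΛ K)))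
  substituted-t : subΛ (extsΛ (singleΛ L)) (barR (ext2 ρ) t) ≡ barR (ext ρ) t
  substituted-t = subΛ-barR (actsAsRenaming λ { zero → refl ; (suc _) → refl }) t

simulate-σ : ∀ {n m} (ρ : Ren n m) t c K → cpsC ρ (cmd t (mu c)) K →β* cpsC ρ (c [ t /0]C) K
simulate-σ ρ t c K =
  β _ _ ◅ subΛ-cpsC-→β* (instantiates substitutes) c (wkΛ K)
        ◅◅ ≡⇒→β* (cong (cpsC ρ (c [ t /0]C)) (subΛ-single-wkΛ (barR ρ t) K))
  where
  substitutes : ∀ i → Translates ρ (single t i) (singleΛ (barR ρ t) (ext ρ i))
  substitutes zero    = translated
  substitutes (suc i) = renamed

simulate-π : ∀ {n m} {E : CoTerm n} → EvalCtx E → ∀ (ρ : Ren n m) t l K →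
             cpsC ρ (cmd (brace (cmd t l)) E) K →β* cpsC ρ (cmd t (l ++L E)) K
simulate-π ec-nil          ρ t l K = ≡⇒→β* (cpsC-++L ec-nil ρ t l K)
simulate-π (ec-cons u l')  ρ t l K = ≡⇒→β* (cpsC-++L (ec-cons u l') ρ t l K)

simulate-μ : ∀ {n m} (ρ : Ren n m) l K → cpsL ρ (mu (cmd (var zero) (wkL l))) K →β* cpsL ρ l K
simulate-μ ρ nil        K = ε
simulate-μ ρ (cons u l) K =
  ≡⇒→β* (cong₂ (λ a b → ƛ (` zero · ƛ (` zero · a · b))) (cpsL-renL h l _) (barR-renT h u))
  where h = factors λ _ → refl
simulate-μ ρ (mu c)     K =
  ξ-ƛ (β _ _) ◅ ξ-ƛ* (≡⇒→β* (cong (subΛ (singleΛ x)) (cpsC-renC (factors λ _ → refl) c _))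
                     ◅◅ subΛ-cpsC-→β* (instantiates η-expands) c (wkΛ (wkΛ K))
                     ◅◅ ≡⇒→β* (cong₂ (cpsC (ext ρ)) (subC-var (λ _ → refl) c)
                                                   (subΛ-single-wkΛ x (wkΛ K))))
  where
  x = barR (ext ρ) (var zero)
  η-expands : ∀ i → Translates (ext ρ) (var i) (singleΛ x (ext (ext ρ) (ext suc i)))
  η-expands zero    = translated
  η-expands (suc i) = renamed

mutual
  simulateT : ∀ {n m} {t t' : Term n} → t ⟶T t' → ∀ (ρ : Ren n m) K → cpsT ρ t K →β* cpsT ρ t' K
  simulateT (ε-rule t)     ρ K = ε
  simulateT (lam-cong s)   ρ K = ξ-·ʳ* (ξ-ƛ* (ξ-ƛ* (ξ-·ʳ* (simulate-barR s (ext2 ρ)))))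
  simulateT (brace-cong s) ρ K = simulateC s ρ K

  simulate-barR : ∀ {n m} {t t' : Term n} → t ⟶T t' → ∀ (ρ : Ren n m) → barR ρ t →β* barR ρ t'
  simulate-barR s ρ = ξ-ƛ* (simulateT s (wk1 ρ) (` zero))

  simulateL : ∀ {n m} {l l' : CoTerm n} → l ⟶L l' → ∀ (ρ : Ren n m) K → cpsL ρ l K →β* cpsL ρ l' K
  simulateL (μ-rule l)      ρ K = simulate-μ ρ l K
  simulateL (cons-congˡ s)  ρ K = ξ-ƛ* (ξ-·ʳ* (ξ-ƛ* (ξ-·ʳ* (simulate-barR s (wk2 ρ)))))
  simulateL (cons-congʳ s)  ρ K = ξ-ƛ* (ξ-·ʳ* (ξ-ƛ* (ξ-·ˡ* (ξ-·ʳ* (simulateL s (wk2 ρ) _)))))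
  simulateL (mu-cong s)     ρ K = ξ-ƛ* (simulateC s (ext ρ) (wkΛ K))

  simulateC : ∀ {n m} {c c' : Cmd n} → c ⟶C c' → ∀ (ρ : Ren n m) K → cpsC ρ c K →β* cpsC ρ c' K
  simulateC (β-rule t u l)                   ρ K = simulate-β ρ t u l K
  simulateC (π-rule t l E e)                 ρ K = simulate-π e ρ t l K
  simulateC (σ-rule t c)                     ρ K = simulate-σ ρ t c K
  simulateC (cmd-congˡ {l = nil} s)          ρ K = simulateT s ρ K
  simulateC (cmd-congˡ {l = cons u l} s)     ρ K = simulateT s ρ _
  simulateC (cmd-congˡ {l = mu c} s)         ρ K = ξ-·ʳ* (simulate-barR s ρ)
  -- a μ-step may change the head constructor of the co-term, which (t l : K) inspects
  simulateC (cmd-congʳ {t = t} (μ-rule l))   ρ K = ξ-·ˡ* (simulate-μ ρ l K) ◅◅ cpsL-app ρ l t K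
  simulateC (cmd-congʳ {t = t} (cons-congˡ s)) ρ K =
    cpsT-mono* ρ t (ξ-ƛ* (ξ-·ʳ* (simulate-barR s (wk1 ρ))))
  simulateC (cmd-congʳ {t = t} (cons-congʳ s)) ρ K =
    cpsT-mono* ρ t (ξ-ƛ* (ξ-·ˡ* (ξ-·ʳ* (simulateL s (wk1 ρ) _))))
  simulateC (cmd-congʳ (mu-cong s))          ρ K = ξ-·ˡ* (simulateL (mu-cong s) ρ K)

proposition4p1 : ∀ {n} {t u : Term n} → t ⟶T u → bar t →β* bar u
proposition4p1 s = simulate-barR s id
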